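{- Let $G$ be an abelian group and let $A,B\subseteq G$ be finite, nonempty subsets. Suppose $(A,B)$ is a type (III) elementary pair with $a_0+b_0$ the unique expression element in $A+B$, where $a_0\in A$ and $b_0\in B$. Then $$(A\setminus\{a_0\})+(B\setminus\{b_0\})=(A+B)\setminus\{a_0+b_0\}.$$
   Context: For $X,Y\subseteq G$, $X+Y=\{x+y:x\in X,y\in Y\}$. An element $c\in X+Y$ is a unique expression element if there is exactly one pair $(x,y)\in X\times Y$ with $x+y=c$. For a nonempty $X\subseteq G$, $\langle X\rangle_*$ denotes the subgroup generated by $X-X$. For finite nonempty $X,Y\subseteq G$ with $K=\langle X+Y\rangle_*$, the pair $(X,Y)$ is called elementary of type (III) if there are $z_A,z_B\in G$ and subsets $A',B'\subseteq K$ with $X=z_A+A'$, $Y=z_B+B'$, $|A'|+|B'|=|K|+1$, and the sumset $A'+B'$ contains precisely one unique expression element (in particular then $A'+B'=K$, $|A'|,|B'|\geq 3$ and $|K|\geq 5$). -}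

module Defs where

open import Level using (Level; _⊔_)
open import Algebra.Bundles using (AbelianGroup)
open import Data.Nat using (ℕ; _+_; _≥_)
open import Data.Fin using (Fin)
open import Data.Product using (Σ; ∃; _×_; _,_)
open import Relation.Unary using (Pred)
open import Relation.Nullary using (¬_)
open import Relation.Binary.PropositionalEquality using (_≡_)

-- Additive-subset combinatorics in an abelian group G (written multiplicatively
-- in the stdlib bundle: _∙_ is the group operation "+", ε the zero, _⁻¹ negation).
module Sumsets {c ℓ : Level} (G : AbelianGroup c ℓ) where
  open AbelianGroup G

  _⊕_ : ∀ {p q} → Pred Carrier p → Pred Carrier q → Pred Carrier (c ⊔ ℓ ⊔ p ⊔ q)
  (X ⊕ Y) g = Σ Carrier λ x → Σ Carrier λ y → X x × Y y × (x ∙ y ≈ g)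

  _⊖_ : ∀ {p q} → Pred Carrier p → Pred Carrier q → Pred Carrier (c ⊔ ℓ ⊔ p ⊔ q)
  (X ⊖ Y) g = Σ Carrier λ x → Σ Carrier λ y → X x × Y y × (x ∙ (y ⁻¹) ≈ g)

  _+ₜ_ : ∀ {p} → Carrier → Pred Carrier p → Pred Carrier (c ⊔ ℓ ⊔ p)
  (z +ₜ X) g = Σ Carrier λ x → X x × (z ∙ x ≈ g)

  _∖[_] : ∀ {p} → Pred Carrier p → Carrier → Pred Carrier (ℓ ⊔ p)
  (X ∖[ a ]) g = X g × ¬ (g ≈ a)

  _≐_ : ∀ {p q} → Pred Carrier p → Pred Carrier q → Set (c ⊔ p ⊔ q)
  X ≐ Y = ∀ g → (X g → Y g) × (Y g → X g)

  _⊆_ : ∀ {p q} → Pred Carrier p → Pred Carrier q → Set (c ⊔ p ⊔ q)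
  X ⊆ Y = ∀ g → X g → Y g

  data Gen {p} (S : Pred Carrier p) : Pred Carrier (c ⊔ ℓ ⊔ p) where
    gen  : ∀ {x} → S x → Gen S x
    unit : Gen S ε
    op   : ∀ {x y} → Gen S x → Gen S y → Gen S (x ∙ y)
    inv  : ∀ {x} → Gen S x → Gen S (x ⁻¹)
    resp : ∀ {x y} → x ≈ y → Gen S x → Gen S y

  ⟨_⟩* : ∀ {p} → Pred Carrier p → Pred Carrier (c ⊔ ℓ ⊔ p)
  ⟨ X ⟩* = Gen (X ⊖ X)

  HasSize : ∀ {p} → Pred Carrier p → ℕ → Set (c ⊔ ℓ ⊔ p)
  HasSize X n = Σ (Fin n → Carrier) λ f →
      (∀ i → X (f i))
    × (∀ i j → f i ≈ f j → i ≡ j)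
    × (∀ x → X x → Σ (Fin n) λ i → x ≈ f i)

  Finite : ∀ {p} → Pred Carrier p → Set (c ⊔ ℓ ⊔ p)
  Finite X = Σ ℕ λ n → HasSize X n

  NonEmpty : ∀ {p} → Pred Carrier p → Set (c ⊔ p)
  NonEmpty X = Σ Carrier X

  Resp : ∀ {p} → Pred Carrier p → Set (c ⊔ ℓ ⊔ p)
  Resp X = ∀ {x y} → x ≈ y → X x → X y

  UniqueExpr : ∀ {p q} → Pred Carrier p → Pred Carrier q → Carrier → Set (c ⊔ ℓ ⊔ p ⊔ q)
  UniqueExpr X Y g = Σ Carrier λ x → Σ Carrier λ y → X x × Y y × (x ∙ y ≈ g)
    × (∀ x' y' → X x' → Y y' → x' ∙ y' ≈ g → (x' ≈ x) × (y' ≈ y))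

  ExactlyOneUniqueExpr : ∀ {p q} → Pred Carrier p → Pred Carrier q → Set (c ⊔ ℓ ⊔ p ⊔ q)
  ExactlyOneUniqueExpr X Y = Σ Carrier λ g → UniqueExpr X Y g
    × (∀ g' → UniqueExpr X Y g' → g' ≈ g)

  TypeIII : ∀ {p} → Pred Carrier p → Pred Carrier p → Set (Level.suc (c ⊔ ℓ ⊔ p))
  TypeIII {p} X Y =
    Σ Carrier λ zA → Σ Carrier λ zB →
    Σ (Pred Carrier (c ⊔ ℓ ⊔ p)) λ A' → Σ (Pred Carrier (c ⊔ ℓ ⊔ p)) λ B' →
      Resp A' × Resp B'
    × A' ⊆ ⟨ X ⊕ Y ⟩* × B' ⊆ ⟨ X ⊕ Y ⟩*
    × X ≐ (zA +ₜ A') × Y ≐ (zB +ₜ B')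
    × (Σ ℕ λ nA → Σ ℕ λ nB → Σ ℕ λ nK →
         HasSize A' nA × HasSize B' nB × HasSize ⟨ X ⊕ Y ⟩* nK
       × nA + nB ≡ nK + 1)
    × ExactlyOneUniqueExpr A' B'

{-# OPTIONS --safe #-}
module Submission where

-- Translating A and B into K = ⟨A + B⟩*, we have |A| + |B| = |K| + 1, so counting gives
-- A + B = K and K = A ∪ (c₀ - B) for c₀ = a₀ + b₀.  Given g ≠ c₀ in A + B, put t = g - c₀.
-- Any x ∈ A with x ≠ a₀ and x - t ∉ A yields the representation x + (g - x) avoiding a₀ and
-- b₀.  If a₀ were the only such x, then g (when a₀ - t ∈ A) or else c₀ - t would be a second
-- unique expression element: translating by t shows that A has as many points leaving it in
-- direction t as in direction -t.

open import Defs
open import Level using (Level; _⊔_)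
open import Algebra.Bundles using (AbelianGroup)
open import Data.Fin using (Fin; zero; suc; splitAt; join; _≟_)
open import Data.Fin.Properties using (any?; pigeonhole; join-splitAt)
import Data.Fin.Properties as Fin
open import Data.Nat using (ℕ; _+_; _≤_; _<_)
open import Data.Nat.Properties using (≮⇒≥; <⇒≱; 1+n≰n; +-comm; n<1+n)
open import Data.Product using (∃; _×_; _,_; proj₁; proj₂)
open import Data.Sum using (_⊎_; inj₁; inj₂; [_,_]; [_,_]′)
open import Data.Vec.Functional using (_∷_; _++_; updateAt)
open import Data.Vec.Functional.Properties using (updateAt-updates; updateAt-minimal)
open import Function using (_∘_; const)
open import Function.Definitions using (Injective)
open import Relation.Nullary using (¬_; Dec; yes; no; contradiction)
open import Relation.Nullary.Decidable using (map′; decidable-stable; ¬?; _×-dec_)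
open import Relation.Unary using (Pred)
open import Relation.Binary.PropositionalEquality as ≡ using (_≡_; _≢_; cong)

module CriticalPairs {c ℓ : Level} (G : AbelianGroup c ℓ) where
  open AbelianGroup G
  open Sumsets G
  open import Algebra.Properties.AbelianGroup G
  open import Algebra.Properties.CommutativeSemigroup commutativeSemigroup
    using (xy∙z≈xz∙y; interchange)
  open import Relation.Binary.Reasoning.Setoid setoid

  record IsInjectiveFamily {p n} (X : Pred Carrier p) (f : Fin n → Carrier) : Set (ℓ ⊔ p) where
    constructor _,_
    field
      member    : ∀ i → X (f i)
      injective : Injective _≡_ _≈_ f

  module _ {p} {X : Pred Carrier p} where

    ∷-injectiveFamily : ∀ {n x} {f : Fin n → Carrier} → X x → (∀ i → ¬ f i ≈ x) →
                        IsInjectiveFamily X f → IsInjectiveFamily X (x ∷ f)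
    ∷-injectiveFamily {x = x} {f} x∈X x∉f (f∈X , f-inj) = ∈X , inj
      where
      ∈X : ∀ i → X ((x ∷ f) i)
      ∈X zero    = x∈X
      ∈X (suc i) = f∈X i
      inj : Injective _≡_ _≈_ (x ∷ f)
      inj {zero}  {zero}  _  = ≡.refl
      inj {zero}  {suc j} eq = contradiction (sym eq) (x∉f j)
      inj {suc i} {zero}  eq = contradiction eq (x∉f i)
      inj {suc i} {suc j} eq = cong suc (f-inj eq)

    ++-injectiveFamily : ∀ {m n} {f : Fin m → Carrier} {g : Fin n → Carrier} →
                         (∀ i j → ¬ f i ≈ g j) → IsInjectiveFamily X f → IsInjectiveFamily X g →
                         IsInjectiveFamily X (f ++ g)
    ++-injectiveFamily {m} {n} {f} {g} f∩g=∅ (f∈X , f-inj) (g∈X , g-inj) =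
      ∈X ∘ splitAt m , λ eq → splitAt-injective (inj eq)
      where
      ∈X : ∀ u → X ([ f , g ] u)
      ∈X (inj₁ i) = f∈X i
      ∈X (inj₂ j) = g∈X j
      inj : Injective _≡_ _≈_ [ f , g ]
      inj {inj₁ i} {inj₁ j} eq = cong inj₁ (f-inj eq)
      inj {inj₁ i} {inj₂ j} eq = contradiction eq (f∩g=∅ i j)
      inj {inj₂ i} {inj₁ j} eq = contradiction (sym eq) (f∩g=∅ j i)
      inj {inj₂ i} {inj₂ j} eq = cong inj₂ (g-inj eq)
      splitAt-injective : ∀ {i j} → splitAt m i ≡ splitAt m j → i ≡ j
      splitAt-injective {i} {j} eq =
        ≡.trans (≡.sym (join-splitAt m n i)) (≡.trans (cong (join m n) eq) (join-splitAt m n j))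

    updateAt-injectiveFamily :
      ∀ {n i y} {f : Fin n → Carrier} → (∀ j → j ≢ i → X (f j)) → Injective _≡_ _≈_ f →
      X y → (∀ j → j ≢ i → ¬ f j ≈ y) → IsInjectiveFamily X (updateAt f i (const y))
    updateAt-injectiveFamily {i = i} {y} {f} f∈X f-inj y∈X y∉f = ∈X , inj
      where
      F = updateAt f i (const y)
      F-at : F i ≈ y
      F-at = reflexive (updateAt-updates i f)
      F-off : ∀ {j} → j ≢ i → F j ≈ f j
      F-off j≢i = reflexive (updateAt-minimal _ i f j≢i)
      ∈X : ∀ j → X (F j)
      ∈X j with j ≟ i
      ... | yes ≡.refl = ≡.subst X (≡.sym (updateAt-updates i f)) y∈X
      ... | no j≢i     = ≡.subst X (≡.sym (updateAt-minimal j i f j≢i)) (f∈X j j≢i)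
      inj : Injective _≡_ _≈_ F
      inj {j} {k} eq with j ≟ i | k ≟ i
      ... | yes ≡.refl | yes ≡.refl = ≡.refl
      ... | yes ≡.refl | no k≢i     = contradiction (trans (sym (F-off k≢i)) (trans (sym eq) F-at)) (y∉f k k≢i)
      ... | no j≢i     | yes ≡.refl = contradiction (trans (sym (F-off j≢i)) (trans eq F-at)) (y∉f j j≢i)
      ... | no j≢i     | no k≢i     = f-inj (trans (sym (F-off j≢i)) (trans eq (F-off k≢i)))

  x//y≈z⇒x≈z∙y : ∀ {x y z} → x - y ≈ z → x ≈ z ∙ y
  x//y≈z⇒x≈z∙y {x} {y} eq = trans (sym (//-rightDividesˡ y x)) (∙-congʳ eq)

  x≈z//y⇒x∙y≈z : ∀ {x y z} → x ≈ z - y → x ∙ y ≈ z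
  x≈z//y⇒x∙y≈z {y = y} {z} eq = trans (∙-congʳ eq) (//-rightDividesˡ y z)

  x∙y≈z⇒y≈z//x : ∀ {x y z} → x ∙ y ≈ z → y ≈ z - x
  x∙y≈z⇒y≈z//x {x} {y} {z} eq = x≈z//y y x z (trans (comm y x) eq)

  x∙[y//x]≈y : ∀ x y → x ∙ (y - x) ≈ y
  x∙[y//x]≈y x y = trans (comm x (y - x)) (//-rightDividesˡ x y)

  z//x≈z//y⇒x≈y : ∀ {x y z} → z - x ≈ z - y → x ≈ y
  z//x≈z//y⇒x≈y {x} {y} {z} eq = ⁻¹-injective (∙-cancelˡ z (x ⁻¹) (y ⁻¹) eq)

  x//y≈x⇒y≈ε : ∀ {x y} → x - y ≈ x → y ≈ ε
  x//y≈x⇒y≈ε {x} {y} eq = ⁻¹-injective (trans (identityʳ-unique x (y ⁻¹) eq) (sym ε⁻¹≈ε))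

  x∙y≈z∙t⇒[x//t]∙y≈z : ∀ {x y z t} → x ∙ y ≈ z ∙ t → (x - t) ∙ y ≈ z
  x∙y≈z∙t⇒[x//t]∙y≈z {x} {y} {z} {t} eq = begin
    (x - t) ∙ y    ≈⟨ xy∙z≈xz∙y x (t ⁻¹) y ⟩
    (x ∙ y) - t    ≈⟨ ∙-congʳ eq ⟩
    (z ∙ t) - t    ≈⟨ //-rightDividesʳ t z ⟩
    z              ∎

  [x//t]∙y≈z⇒x∙y≈z∙t : ∀ {x y z t} → (x - t) ∙ y ≈ z → x ∙ y ≈ z ∙ t
  [x//t]∙y≈z⇒x∙y≈z∙t {x} {y} {z} {t} eq = begin
    x ∙ y              ≈⟨ ∙-congʳ (//-rightDividesˡ t x) ⟨
    ((x - t) ∙ t) ∙ y  ≈⟨ xy∙z≈xz∙y (x - t) t y ⟩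
    ((x - t) ∙ y) ∙ t  ≈⟨ ∙-congʳ eq ⟩
    z ∙ t              ∎

  x∙y≈z//t⇒[x∙t]∙y≈z : ∀ {x y z t} → x ∙ y ≈ z - t → (x ∙ t) ∙ y ≈ z
  x∙y≈z//t⇒[x∙t]∙y≈z {x} {y} {z} {t} eq = begin
    (x ∙ t) ∙ y    ≈⟨ xy∙z≈xz∙y x t y ⟩
    (x ∙ y) ∙ t    ≈⟨ ∙-congʳ eq ⟩
    (z - t) ∙ t    ≈⟨ //-rightDividesˡ t z ⟩
    z              ∎

  module Enumeration {p} {X : Pred Carrier p} {m} (X-size : HasSize X m) where

    enum : Fin m → Carrier
    enum = proj₁ X-size

    enum-∈ : ∀ i → X (enum i)
    enum-∈ = proj₁ (proj₂ X-size)

    enum-injective : Injective _≡_ _≈_ enum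
    enum-injective = proj₁ (proj₂ (proj₂ X-size)) _ _

    index : ∀ {x} → X x → Fin m
    index {x} x∈X = proj₁ (proj₂ (proj₂ (proj₂ X-size)) x x∈X)

    ≈-enum-index : ∀ {x} (x∈X : X x) → x ≈ enum (index x∈X)
    ≈-enum-index {x} x∈X = proj₂ (proj₂ (proj₂ (proj₂ X-size)) x x∈X)

    index-injective : ∀ {x y} (x∈X : X x) (y∈X : X y) → index x∈X ≡ index y∈X → x ≈ y
    index-injective x∈X y∈X eq =
      trans (≈-enum-index x∈X) (trans (reflexive (cong enum eq)) (sym (≈-enum-index y∈X)))

    ≈-dec : ∀ {x y} → X x → X y → Dec (x ≈ y)
    ≈-dec x∈X y∈X = map′ (index-injective x∈X y∈X)
      (λ x≈y → enum-injective (trans (sym (≈-enum-index x∈X)) (trans x≈y (≈-enum-index y∈X))))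
      (index x∈X ≟ index y∈X)

    ∃-dec : ∀ {r} {P : Pred Carrier r} → (∀ {x y} → x ≈ y → P x → P y) →
            (∀ {x} → X x → Dec (P x)) → Dec (∃ λ x → X x × P x)
    ∃-dec P-resp P? = map′ (λ (i , Pi) → enum i , enum-∈ i , Pi)
      (λ (x , x∈X , Px) → index x∈X , P-resp (≈-enum-index x∈X) Px)
      (any? (λ i → P? (enum-∈ i)))

    family-size-≤ : ∀ {n} {f : Fin n → Carrier} → IsInjectiveFamily X f → n ≤ m
    family-size-≤ (f∈X , f-inj) = ≮⇒≥ λ m<n →
      let i , j , i<j , same-index = pigeonhole m<n (index ∘ f∈X)
      in Fin.<⇒≢ i<j (f-inj (index-injective (f∈X i) (f∈X j) same-index))

    -- x leaves X in direction t if x ∙ t ∉ X.  The map x ↦ x - t sends the points not leaving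
    -- in direction t⁻¹ injectively into X and misses every point leaving in direction t.
    leaving-unique-by-inverse :
      ∀ {a t e₁ e₂} → Resp X → X a → (∀ {x} → X x → Dec (X (x - t))) →
      (∀ {x} → X x → ¬ X (x - t) → x ≈ a) →
      X e₁ → ¬ X (e₁ ∙ t) → X e₂ → ¬ X (e₂ ∙ t) → e₁ ≈ e₂
    leaving-unique-by-inverse {a} {t} {e₁} {e₂} X-resp a∈X X? leaves⁻¹⇒a e₁∈X e₁t∉X e₂∈X e₂t∉X =
      decidable-stable (≈-dec e₁∈X e₂∈X) λ e₁≉e₂ →
        1+n≰n (family-size-≤ (∷-injectiveFamily e₂∈X (e₂∉ e₁≉e₂) shifted))
      where
      i₀ = index a∈X
      shift : Fin m → Carrier
      shift i = enum i - t
      shift-∈ : ∀ i → i ≢ i₀ → X (shift i)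
      shift-∈ i i≢i₀ = decidable-stable (X? (enum-∈ i)) λ shift∉X →
        i≢i₀ (enum-injective (trans (leaves⁻¹⇒a (enum-∈ i) shift∉X) (≈-enum-index a∈X)))
      shift-injective : Injective _≡_ _≈_ shift
      shift-injective eq = enum-injective (∙-cancelʳ (t ⁻¹) _ _ eq)
      shift-misses : ∀ {e} → ¬ X (e ∙ t) → ∀ i → ¬ shift i ≈ e
      shift-misses et∉X i eq = et∉X (X-resp (x//y≈z⇒x≈z∙y eq) (enum-∈ i))
      shifted : IsInjectiveFamily X (updateAt shift i₀ (const e₁))
      shifted = updateAt-injectiveFamily shift-∈ shift-injective e₁∈X (λ i _ → shift-misses e₁t∉X i)
      e₂∉ : ¬ e₁ ≈ e₂ → ∀ i → ¬ updateAt shift i₀ (const e₁) i ≈ e₂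
      e₂∉ e₁≉e₂ i with i ≟ i₀
      ... | yes ≡.refl = e₁≉e₂ ∘ trans (sym (reflexive (updateAt-updates i₀ shift)))
      ... | no i≢i₀    = shift-misses e₂t∉X i ∘ trans (sym (reflexive (updateAt-minimal i i₀ shift i≢i₀)))

  ∈-dec : ∀ {k a nK nA x} {K : Pred Carrier k} {A : Pred Carrier a} →
          HasSize K nK → HasSize A nA → A ⊆ K → Resp A → K x → Dec (A x)
  ∈-dec K-size A-size A⊆K A-resp x∈K =
    map′ (λ (_ , a∈A , a≈x) → A-resp a≈x a∈A) (λ x∈A → _ , x∈A , refl)
      (Enumeration.∃-dec A-size (λ a≈b a≈x → trans (sym a≈b) a≈x)
        (λ a∈A → Enumeration.≈-dec K-size (A⊆K _ a∈A) x∈K))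

  UniqueAt : ∀ {p q} → Pred Carrier p → Pred Carrier q → Carrier → Carrier → Set _
  UniqueAt X Y x₀ y₀ = ∀ {x y} → X x → Y y → x ∙ y ≈ x₀ ∙ y₀ → x ≈ x₀ × y ≈ y₀

  Avoidable : ∀ {p q} → Pred Carrier p → Pred Carrier q → Carrier → Carrier → Set _
  Avoidable X Y x₀ y₀ = ((X ⊕ Y) ∖[ x₀ ∙ y₀ ]) ⊆ ((X ∖[ x₀ ]) ⊕ (Y ∖[ y₀ ]))

  module _ {p q} {X : Pred Carrier p} {Y : Pred Carrier q} where

    ⊕-resp : Resp (X ⊕ Y)
    ⊕-resp g≈h (x , y , x∈X , y∈Y , x∙y≈g) = x , y , x∈X , y∈Y , trans x∙y≈g g≈h

    uniqueExpr⇒uniqueAt : ∀ {x₀ y₀} → X x₀ → Y y₀ → UniqueExpr X Y (x₀ ∙ y₀) → UniqueAt X Y x₀ y₀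
    uniqueExpr⇒uniqueAt x₀∈X y₀∈Y (_ , _ , _ , _ , _ , only) x∈X y∈Y eq =
      let x≈x₁ , y≈y₁ = only _ _ x∈X y∈Y eq
          x₀≈x₁ , y₀≈y₁ = only _ _ x₀∈X y₀∈Y refl
      in trans x≈x₁ (sym x₀≈x₁) , trans y≈y₁ (sym y₀≈y₁)

    first-determined⇒uniqueExpr : ∀ {x₀ y₀ g} → X x₀ → Y y₀ → x₀ ∙ y₀ ≈ g →
      (∀ {x y} → X x → Y y → x ∙ y ≈ g → x ≈ x₀) → UniqueExpr X Y g
    first-determined⇒uniqueExpr {x₀} {y₀} x₀∈X y₀∈Y x₀∙y₀≈g determined =
      x₀ , y₀ , x₀∈X , y₀∈Y , x₀∙y₀≈g , λ _ _ x∈X y∈Y x∙y≈g →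
        let x≈x₀ = determined x∈X y∈Y x∙y≈g
        in x≈x₀ , ∙-cancelˡ x₀ _ _ (trans (∙-congʳ (sym x≈x₀)) (trans x∙y≈g (sym x₀∙y₀≈g)))

    uniqueAt⇒avoiding⊆ : ∀ {x₀ y₀} → UniqueAt X Y x₀ y₀ →
      ((X ∖[ x₀ ]) ⊕ (Y ∖[ y₀ ])) ⊆ ((X ⊕ Y) ∖[ x₀ ∙ y₀ ])
    uniqueAt⇒avoiding⊆ unique g (x , y , (x∈X , x≉x₀) , (y∈Y , _) , x∙y≈g) =
      (x , y , x∈X , y∈Y , x∙y≈g) , λ g≈x₀∙y₀ → x≉x₀ (proj₁ (unique x∈X y∈Y (trans x∙y≈g g≈x₀∙y₀)))

  module CriticalPair
    {k a b} {K : Pred Carrier k} {A : Pred Carrier a} {B : Pred Carrier b}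
    (K-resp : Resp K) (K-∙ : ∀ {x y} → K x → K y → K (x ∙ y)) (K-⁻¹ : ∀ {x} → K x → K (x ⁻¹))
    (A-resp : Resp A) (B-resp : Resp B) (A⊆K : A ⊆ K) (B⊆K : B ⊆ K)
    {nA nB nK : ℕ} (A-size : HasSize A nA) (B-size : HasSize B nB) (K-size : HasSize K nK)
    (critical : nA + nB ≡ nK + 1)
    where

    module EA = Enumeration A-size
    module EB = Enumeration B-size
    module EK = Enumeration K-size

    K-- : ∀ {x y} → K x → K y → K (x - y)
    K-- x∈K y∈K = K-∙ x∈K (K-⁻¹ y∈K)

    ⊕⊆K : (A ⊕ B) ⊆ K
    ⊕⊆K _ (_ , _ , x∈A , y∈B , x∙y≈g) = K-resp x∙y≈g (K-∙ (A⊆K _ x∈A) (B⊆K _ y∈B))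

    A? : ∀ {x} → K x → Dec (A x)
    A? = ∈-dec K-size A-size A⊆K A-resp

    B? : ∀ {x} → K x → Dec (B x)
    B? = ∈-dec K-size B-size B⊆K B-resp

    enumA-in-K : IsInjectiveFamily K EA.enum
    enumA-in-K = A⊆K _ ∘ EA.enum-∈ , EA.enum-injective

    reflectB-in-K : ∀ {h} → K h → IsInjectiveFamily K (λ j → h - EB.enum j)
    reflectB-in-K h∈K = (λ j → K-- h∈K (B⊆K _ (EB.enum-∈ j))) , EB.enum-injective ∘ z//x≈z//y⇒x≈y

    families-meet : ∀ {f : Fin nA → Carrier} {g : Fin nB → Carrier} →
      IsInjectiveFamily K f → IsInjectiveFamily K g → ¬ (∀ i j → ¬ f i ≈ g j)
    families-meet f-in-K g-in-K disjoint =
      <⇒≱ nK<nA+nB (EK.family-size-≤ (++-injectiveFamily disjoint f-in-K g-in-K))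
      where
      nK<nA+nB : nK < nA + nB
      nK<nA+nB = ≡.subst (nK <_) (≡.sym (≡.trans critical (+-comm nK 1))) (n<1+n nK)

    ⊕-full : ∀ {h} → K h → (A ⊕ B) h
    ⊕-full {h} h∈K
      with EA.∃-dec (λ x≈y → B-resp (∙-congˡ (⁻¹-cong x≈y))) (λ x∈A → B? (K-- h∈K (A⊆K _ x∈A)))
    ... | yes (x , x∈A , h-x∈B) = x , h - x , x∈A , h-x∈B , x∙[y//x]≈y x h
    ... | no ∄ = contradiction disjoint (families-meet enumA-in-K (reflectB-in-K h∈K))
      where
      disjoint : ∀ i j → ¬ EA.enum i ≈ h - EB.enum j
      disjoint i j eq = ∄ (_ , EA.enum-∈ i , B-resp (x∙y≈z⇒y≈z//x (x≈z//y⇒x∙y≈z eq)) (EB.enum-∈ j))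

    module _ {a₀ b₀} (a₀∈A : A a₀) (b₀∈B : B b₀)
             (unique : UniqueAt A B a₀ b₀) (one : ExactlyOneUniqueExpr A B) where

      c₀ : Carrier
      c₀ = a₀ ∙ b₀

      c₀∈K : K c₀
      c₀∈K = K-∙ (A⊆K _ a₀∈A) (B⊆K _ b₀∈B)

      only-c₀ : ∀ {g} → UniqueExpr A B g → g ≈ c₀
      only-c₀ g-unique = trans (all _ g-unique) (sym (all _ c₀-unique))
        where
        all = proj₂ (proj₂ one)
        c₀-unique = first-determined⇒uniqueExpr a₀∈A b₀∈B refl λ x∈A y∈B eq → proj₁ (unique x∈A y∈B eq)

      cover : ∀ {x} → K x → A x ⊎ ∃ λ y → B y × x ∙ y ≈ c₀
      cover {x} x∈K with A? x∈K | B? (K-- c₀∈K x∈K)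
      ... | yes x∈A | _           = inj₁ x∈A
      ... | no _    | yes c₀-x∈B = inj₂ (c₀ - x , c₀-x∈B , x∙[y//x]≈y x c₀)
      ... | no x∉A  | no c₀-x∉B  = contradiction disjoint (families-meet enumA-in-K replaced)
        where
        j₀ = EB.index b₀∈B
        reflection = λ j → c₀ - EB.enum j
        open IsInjectiveFamily (reflectB-in-K c₀∈K)
        -- c₀ - B meets A only in c₀ - b₀ = a₀; putting x in that slot makes the two families disjoint.
        replaced : IsInjectiveFamily K (updateAt reflection j₀ (const x))
        replaced = updateAt-injectiveFamily (λ j _ → member j) injective x∈K
          (λ j _ eq → c₀-x∉B (B-resp (x∙y≈z⇒y≈z//x (sym (x//y≈z⇒x≈z∙y eq))) (EB.enum-∈ j)))
        disjoint : ∀ i j → ¬ EA.enum i ≈ updateAt reflection j₀ (const x) j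
        disjoint i j eq with j ≟ j₀
        ... | yes ≡.refl = x∉A (A-resp (trans eq (reflexive (updateAt-updates j₀ reflection))) (EA.enum-∈ i))
        ... | no j≢j₀    = j≢j₀ (EB.enum-injective (trans b≈b₀ (EB.≈-enum-index b₀∈B)))
          where
          b≈b₀ = proj₂ (unique (EA.enum-∈ i) (EB.enum-∈ j)
                   (x≈z//y⇒x∙y≈z (trans eq (reflexive (updateAt-minimal j j₀ reflection j≢j₀)))))

      module _ {t} (t∈K : K t) where

        leaving-resp : ∀ {x y} → x ≈ y → ¬ A (x - t) × ¬ x ≈ a₀ → ¬ A (y - t) × ¬ y ≈ a₀
        leaving-resp x≈y (x-t∉A , x≉a₀) =
          (λ y-t∈A → x-t∉A (A-resp (∙-congʳ (sym x≈y)) y-t∈A)) , (λ y≈a₀ → x≉a₀ (trans x≈y y≈a₀))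

        leaving⇒avoiding : ∀ {x} → A x → ¬ A (x - t) → ¬ x ≈ a₀ →
                           ((A ∖[ a₀ ]) ⊕ (B ∖[ b₀ ])) (c₀ ∙ t)
        leaving⇒avoiding {x} x∈A x-t∉A x≉a₀ with cover (K-- (A⊆K _ x∈A) t∈K)
        ... | inj₁ x-t∈A = contradiction x-t∈A x-t∉A
        ... | inj₂ (y , y∈B , [x-t]∙y≈c₀) =
          x , y , (x∈A , x≉a₀) , (y∈B , y≉b₀) , [x//t]∙y≈z⇒x∙y≈z∙t [x-t]∙y≈c₀
          where
          y≉b₀ : ¬ y ≈ b₀
          y≉b₀ y≈b₀ = x-t∉A (A-resp (sym (∙-cancelʳ b₀ _ _ (trans (∙-congˡ (sym y≈b₀)) [x-t]∙y≈c₀))) a₀∈A)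

        leaving-only-at-a₀-absurd : (A ⊕ B) (c₀ ∙ t) → ¬ t ≈ ε →
                                    ¬ (∀ {x} → A x → ¬ A (x - t) → x ≈ a₀)
        leaving-only-at-a₀-absurd (x₁ , y₁ , x₁∈A , y₁∈B , x₁∙y₁≈c₀t) t≉ε leaving⇒a₀
          with cover (K-- (A⊆K _ a₀∈A) t∈K)
        ... | inj₁ a₀-t∈A =
          t≉ε (identityʳ-unique c₀ t (only-c₀ (first-determined⇒uniqueExpr x₁∈A y₁∈B x₁∙y₁≈c₀t same-first)))
          where
          shifted≈a₀ : ∀ {x y} → A x → B y → x ∙ y ≈ c₀ ∙ t → x - t ≈ a₀
          shifted≈a₀ {x} x∈A y∈B eq = proj₁ (unique x-t∈A y∈B (x∙y≈z∙t⇒[x//t]∙y≈z eq))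
            where
            x-t∈A : A (x - t)
            x-t∈A = decidable-stable (A? (K-- (A⊆K _ x∈A) t∈K)) λ x-t∉A →
              x-t∉A (A-resp (∙-congʳ (sym (leaving⇒a₀ x∈A x-t∉A))) a₀-t∈A)
          same-first : ∀ {x y} → A x → B y → x ∙ y ≈ c₀ ∙ t → x ≈ x₁
          same-first x∈A y∈B eq = ∙-cancelʳ (t ⁻¹) _ _
            (trans (shifted≈a₀ x∈A y∈B eq) (sym (shifted≈a₀ x₁∈A y₁∈B x₁∙y₁≈c₀t)))
        ... | inj₂ (y , y∈B , [a₀-t]∙y≈c₀) with ⊕-full (K-- c₀∈K t∈K)
        ...   | x₀ , y₀ , x₀∈A , y₀∈B , x₀∙y₀≈c₀-t =
          t≉ε (x//y≈x⇒y≈ε (only-c₀ (first-determined⇒uniqueExpr x₀∈A y₀∈B x₀∙y₀≈c₀-t same-first)))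
          where
          a₀-t∉A : ¬ A (a₀ - t)
          a₀-t∉A a₀-t∈A = t≉ε (x//y≈x⇒y≈ε (proj₁ (unique a₀-t∈A y∈B [a₀-t]∙y≈c₀)))
          leaves : ∀ {x y} → A x → B y → x ∙ y ≈ c₀ - t → ¬ A (x ∙ t)
          leaves x∈A y∈B eq x+t∈A =
            a₀-t∉A (A-resp (x≈z//y _ _ _ (proj₁ (unique x+t∈A y∈B (x∙y≈z//t⇒[x∙t]∙y≈z eq)))) x∈A)
          same-first : ∀ {x y} → A x → B y → x ∙ y ≈ c₀ - t → x ≈ x₀
          same-first x∈A y∈B eq = EA.leaving-unique-by-inverse A-resp a₀∈A
            (λ x∈A → A? (K-- (A⊆K _ x∈A) t∈K)) leaving⇒a₀
            x∈A (leaves x∈A y∈B eq) x₀∈A (leaves x₀∈A y₀∈B x₀∙y₀≈c₀-t)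

        avoiding-or-leaving-only-at-a₀ :
          ((A ∖[ a₀ ]) ⊕ (B ∖[ b₀ ])) (c₀ ∙ t) ⊎ (∀ {x} → A x → ¬ A (x - t) → x ≈ a₀)
        avoiding-or-leaving-only-at-a₀
          with EA.∃-dec leaving-resp (λ x∈A → ¬? (A? (K-- (A⊆K _ x∈A) t∈K)) ×-dec ¬? (EA.≈-dec x∈A a₀∈A))
        ... | yes (x , x∈A , x-t∉A , x≉a₀) = inj₁ (leaving⇒avoiding x∈A x-t∉A x≉a₀)
        ... | no ∄ = inj₂ λ x∈A x-t∉A →
          decidable-stable (EA.≈-dec x∈A a₀∈A) λ x≉a₀ → ∄ (_ , x∈A , x-t∉A , x≉a₀)

      avoidable : Avoidable A B a₀ b₀
      avoidable g (g∈A⊕B , g≉c₀) =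
        [ ⊕-resp c₀t≈g , (λ leaving⇒a₀ → contradiction leaving⇒a₀ (leaving-only-at-a₀-absurd t∈K c₀t∈A⊕B t≉ε)) ]′
          (avoiding-or-leaving-only-at-a₀ t∈K)
        where
        t = g - c₀
        t∈K = K-- (⊕⊆K _ g∈A⊕B) c₀∈K
        c₀t≈g = x∙[y//x]≈y c₀ g
        c₀t∈A⊕B = ⊕-resp (sym c₀t≈g) g∈A⊕B
        t≉ε = g≉c₀ ∘ x∙y⁻¹≈ε⇒x≈y g c₀

  module _ {p p′ q q′} {X : Pred Carrier p} {X′ : Pred Carrier p′} {Y : Pred Carrier q} {Y′ : Pred Carrier q′}
           {zX zY : Carrier} (X≐ : X ≐ (zX +ₜ X′)) (Y≐ : Y ≐ (zY +ₜ Y′)) where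

    private
      translateˣ : ∀ {x} → X′ x → X (zX ∙ x)
      translateˣ x∈X′ = proj₂ (X≐ _) (_ , x∈X′ , refl)

      translateʸ : ∀ {y} → Y′ y → Y (zY ∙ y)
      translateʸ y∈Y′ = proj₂ (Y≐ _) (_ , y∈Y′ , refl)

      translate-∙ : ∀ {x y g} → x ∙ y ≈ g → (zX ∙ x) ∙ (zY ∙ y) ≈ (zX ∙ zY) ∙ g
      translate-∙ x∙y≈g = trans (interchange _ _ _ _) (∙-congˡ x∙y≈g)

    uniqueAt-untranslate : ∀ {x₀ y₀ x₀′ y₀′} → zX ∙ x₀′ ≈ x₀ → zY ∙ y₀′ ≈ y₀ →
                           UniqueAt X Y x₀ y₀ → UniqueAt X′ Y′ x₀′ y₀′
    uniqueAt-untranslate zXx₀′≈x₀ zYy₀′≈y₀ unique x∈X′ y∈Y′ x∙y≈x₀′∙y₀′ =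
      let zXx≈x₀ , zYy≈y₀ = unique (translateˣ x∈X′) (translateʸ y∈Y′)
            (trans (translate-∙ x∙y≈x₀′∙y₀′) (trans (sym (translate-∙ refl)) (∙-cong zXx₀′≈x₀ zYy₀′≈y₀)))
      in ∙-cancelˡ zX _ _ (trans zXx≈x₀ (sym zXx₀′≈x₀)) , ∙-cancelˡ zY _ _ (trans zYy≈y₀ (sym zYy₀′≈y₀))

    avoidable-translate : ∀ {x₀ y₀ x₀′ y₀′} → zX ∙ x₀′ ≈ x₀ → zY ∙ y₀′ ≈ y₀ →
                          Avoidable X′ Y′ x₀′ y₀′ → Avoidable X Y x₀ y₀
    avoidable-translate {x₀} {y₀} {x₀′} {y₀′} zXx₀′≈x₀ zYy₀′≈y₀ avoidable′ g
      ((x , y , x∈X , y∈Y , x∙y≈g) , g≉x₀∙y₀)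
      with proj₁ (X≐ x) x∈X | proj₁ (Y≐ y) y∈Y
    ... | x′ , x′∈X′ , zXx′≈x | y′ , y′∈Y′ , zYy′≈y
      with avoidable′ (x′ ∙ y′) ((x′ , y′ , x′∈X′ , y′∈Y′ , refl) , g′≉x₀′∙y₀′)
      where
      g′≉x₀′∙y₀′ : ¬ x′ ∙ y′ ≈ x₀′ ∙ y₀′
      g′≉x₀′∙y₀′ eq = g≉x₀∙y₀ (begin
        g                         ≈⟨ x∙y≈g ⟨
        x ∙ y                     ≈⟨ ∙-cong zXx′≈x zYy′≈y ⟨
        (zX ∙ x′) ∙ (zY ∙ y′)     ≈⟨ translate-∙ eq ⟩
        (zX ∙ zY) ∙ (x₀′ ∙ y₀′)   ≈⟨ translate-∙ refl ⟨
        (zX ∙ x₀′) ∙ (zY ∙ y₀′)   ≈⟨ ∙-cong zXx₀′≈x₀ zYy₀′≈y₀ ⟩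
        x₀ ∙ y₀                   ∎)
    ...   | x″ , y″ , (x″∈X′ , x″≉x₀′) , (y″∈Y′ , y″≉y₀′) , x″∙y″≈g′ =
      zX ∙ x″ , zY ∙ y″ ,
      (translateˣ x″∈X′ , x″≉x₀′ ∘ ∙-cancelˡ zX _ _ ∘ λ eq → trans eq (sym zXx₀′≈x₀)) ,
      (translateʸ y″∈Y′ , y″≉y₀′ ∘ ∙-cancelˡ zY _ _ ∘ λ eq → trans eq (sym zYy₀′≈y₀)) ,
      (begin
        (zX ∙ x″) ∙ (zY ∙ y″)   ≈⟨ translate-∙ x″∙y″≈g′ ⟩
        (zX ∙ zY) ∙ (x′ ∙ y′)   ≈⟨ translate-∙ refl ⟨
        (zX ∙ x′) ∙ (zY ∙ y′)   ≈⟨ ∙-cong zXx′≈x zYy′≈y ⟩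
        x ∙ y                   ≈⟨ x∙y≈g ⟩
        g                       ∎)

open CriticalPairs using (uniqueExpr⇒uniqueAt; uniqueAt⇒avoiding⊆; uniqueAt-untranslate;
                          avoidable-translate; module CriticalPair)

lemma2p1 : ∀ {c ℓ p : Level} (G : AbelianGroup c ℓ) →
    let open AbelianGroup G
        open Sumsets G
    in (A B : Pred Carrier p) → Resp A → Resp B →
       Finite A → Finite B → NonEmpty A → NonEmpty B →
       TypeIII A B →
       (a₀ b₀ : Carrier) → A a₀ → B b₀ → UniqueExpr A B (a₀ ∙ b₀) →
       ((A ∖[ a₀ ]) ⊕ (B ∖[ b₀ ])) ≐ ((A ⊕ B) ∖[ a₀ ∙ b₀ ])
lemma2p1 G A B _ _ _ _ _ _
  (zA , zB , A′ , B′ , A′-resp , B′-resp , A′⊆K , B′⊆K , A≐ , B≐ ,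
   (_ , _ , _ , A′-size , B′-size , K-size , critical) , exactly-one)
  a₀ b₀ a₀∈A b₀∈B a₀∙b₀-unique
  with proj₁ (A≐ a₀) a₀∈A | proj₁ (B≐ b₀) b₀∈B
... | a₀′ , a₀′∈A′ , zAa₀′≈a₀ | b₀′ , b₀′∈B′ , zBb₀′≈b₀ =
  λ g → uniqueAt⇒avoiding⊆ G unique g , avoidable-translate G A≐ B≐ zAa₀′≈a₀ zBb₀′≈b₀ avoidable′ g
  where
  open Sumsets G
  unique = uniqueExpr⇒uniqueAt G a₀∈A b₀∈B a₀∙b₀-unique
  avoidable′ = CriticalPair.avoidable G resp op inv A′-resp B′-resp A′⊆K B′⊆K A′-size B′-size K-size critical
    a₀′∈A′ b₀′∈B′ (uniqueAt-untranslate G A≐ B≐ zAa₀′≈a₀ zBb₀′≈b₀ unique) exactly-one
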